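{- Let $\alpha=12\cdots c$. For any two $S_c$-hits $h$ and $h'$ in a permutation $w\in S_n$ such that $h'$ forms a permutation in $R_c$, $(R_c,\{\alpha\})$-straightening $h$ leaves the letters of $h'$ still forming a permutation in $R_c$.
   Context: Fix positive integers $c\le n$. $S_m$ is the set of permutations of $\{1,\dots,m\}$ written as words. A word $w_1\cdots w_c$ (distinct integer letters) forms $u\in S_c$ if there is an integer $k$ with $w_i=u_i+k$ for all $i$. A hit ($S_c$-hit) in $w\in S_n$ is a contiguous subword of length $c$ forming some $u\in S_c$. Tail size of a word $w$ of length $m$ with distinct letters: least $k\ge1$ such that the first $k$ letters are the $k$ smallest letters of $w$. $w$ is right leaning if its tail size is $<m$, left leaning if its reversal has tail size $<m$, omni leaning if neither. $R_c$ is the set of right leaning permutations in $S_c$. Here $R_c$ is regarded as a partition with the single part $R_c$; an $R_c$-hit is a hit forming a permutation in $R_c$, and an $R_c$-rearrangement rearranges its letters in place so that it still forms a permutation in $R_c$. Polarization of a hit $h$ in $w\in S_n$: if $h$ is all of $w$, $h$ is left polarized. Otherwise let $a$ be the average of the letters of $h$, $w'$ be $w$ with $h$ replaced by the single letter $a$, and $b$ the letter adjacent to $a$ in $w'$ closest in value to $a$ (ties: the left one). If $a,b$ appear in increasing order in $w'$, $h$ is right polarized; if decreasing, left polarized. A hit is backward if it is right polarized and left leaning, or left polarized and right leaning, or omni leaning; otherwise forward. For the partition $P=\{R_c\}$ and $C=\{\alpha\}$: an $R_c$-hit $h$ is $(P,C)$-straightened if it forms $\alpha$ and either it is forward, or it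 is backward and no $R_c$-rearrangement makes it forward. $(R_c,\{\alpha\})$-straightening a hit means applying an $R_c$-rearrangement to it so that it becomes $(P,C)$-straightened (a hit that is not an $R_c$-hit is left unchanged). -}

module Defs where

open import Data.Nat using (ℕ; zero; suc; _+_; _*_; _∸_; _≤_; _<_; _≤ᵇ_; _<ᵇ_; ∣_-_∣)
open import Data.Integer as ℤ using (ℤ; +_)
open import Data.Nat.ListAction using (sum)
open import Data.List using (List; []; _∷_; take; drop; length; map; upTo; reverse; head; last; _++_)
open import Data.List.Membership.Propositional using (_∈_)
open import Data.List.Relation.Binary.Permutation.Propositional using (_↭_)
open import Data.Maybe using (Maybe; just; nothing)
open import Data.Bool using (Bool; true; false; if_then_else_)
open import Data.Product using (Σ; ∃; _×_; _,_)
open import Data.Sum using (_⊎_)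
open import Relation.Nullary using (¬_)
open import Relation.Binary.PropositionalEquality using (_≡_; _≢_)

range1 : ℕ → List ℕ
range1 m = map suc (upTo m)

IsPerm : ℕ → List ℕ → Set
IsPerm m u = u ↭ range1 m

Forms : List ℕ → List ℕ → Set
Forms v u = ∃ λ (k : ℤ) → map +_ v ≡ map (λ x → (+ x) ℤ.+ k) u

FirstAreSmallest : List ℕ → ℕ → Set
FirstAreSmallest w k = ∀ x y → x ∈ take k w → y ∈ drop k w → x < y

TailSize : List ℕ → ℕ → Set
TailSize w t = (1 ≤ t) × FirstAreSmallest w t
             × (∀ k → 1 ≤ k → k < t → ¬ FirstAreSmallest w k)

RightLeaning : List ℕ → Set
RightLeaning w = ∃ λ t → TailSize w t × t < length w

LeftLeaning : List ℕ → Set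
LeftLeaning w = RightLeaning (reverse w)

OmniLeaning : List ℕ → Set
OmniLeaning w = ¬ RightLeaning w × ¬ LeftLeaning w

InR : ℕ → List ℕ → Set
InR c u = IsPerm c u × RightLeaning u

-- the contiguous subword of length c starting at (0-based) position i
sub : List ℕ → ℕ → ℕ → List ℕ
sub w i c = take c (drop i w)

SHit : List ℕ → ℕ → ℕ → Set
SHit w i c = (i + c ≤ length w) × ∃ λ u → IsPerm c u × Forms (sub w i c) u

RHit : List ℕ → ℕ → ℕ → Set
RHit w i c = (i + c ≤ length w) × ∃ λ u → InR c u × Forms (sub w i c) u

-- Polarization.  The average a of the letters of h is s / c with
-- s = sum h; all comparisons with a are made after multiplying by c.
data Pol : Set where
  leftPol rightPol neitherPol : Pol

-- b placed before a : increasing iff b < a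
polBefore : ℕ → ℕ → ℕ → Pol
polBefore c s b = if c * b <ᵇ s then rightPol else (if s <ᵇ c * b then leftPol else neitherPol)

-- b placed after a : increasing iff a < b
polAfter : ℕ → ℕ → ℕ → Pol
polAfter c s b = if s <ᵇ c * b then rightPol else (if c * b <ᵇ s then leftPol else neitherPol)

-- given the left and right neighbours of a in w', pick b (closest in value
-- to a, ties broken to the left) and decide the orientation
orient : ℕ → ℕ → Maybe ℕ → Maybe ℕ → Pol
orient c s nothing  nothing  = neitherPol
orient c s (just l) nothing  = polBefore c s l
orient c s nothing  (just r) = polAfter c s r
orient c s (just l) (just r) =
  if ∣ c * l - s ∣ ≤ᵇ ∣ c * r - s ∣ then polBefore c s l else polAfter c s r

polarization : List ℕ → ℕ → ℕ → Pol
polarization w i c =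
  if length w ≤ᵇ c   -- h is all of w (for a hit, length w ≥ c)
  then leftPol
  else orient c (sum (sub w i c)) (last (take i w)) (head (drop (i + c) w))

Backward : List ℕ → ℕ → ℕ → Set
Backward w i c =
  (polarization w i c ≡ rightPol × LeftLeaning (sub w i c))
  ⊎ (polarization w i c ≡ leftPol × RightLeaning (sub w i c))
  ⊎ OmniLeaning (sub w i c)

Forward : List ℕ → ℕ → ℕ → Set
Forward w i c = ¬ Backward w i c

Rearrangement : List ℕ → ℕ → ℕ → List ℕ → Set
Rearrangement w i c w' =
  RHit w i c ×
  ∃ λ v → (v ↭ sub w i c) × (∃ λ u → InR c u × Forms v u)
        × (w' ≡ take i w ++ v ++ drop (i + c) w)

Straightened : List ℕ → List ℕ → ℕ → ℕ → Set
Straightened α w i c =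
  RHit w i c × Forms (sub w i c) α ×
  (Forward w i c
   ⊎ (Backward w i c × (∀ w'' → Rearrangement w i c w'' → ¬ Forward w'' i c)))

Straightening : List ℕ → List ℕ → ℕ → ℕ → List ℕ → Set
Straightening α w i c w' =
  (RHit w i c → Rearrangement w i c w' × Straightened α w' i c)
  × (¬ RHit w i c → w' ≡ w)

-- A hit is an S_c-hit exactly when its letters are a permutation of an interval of length c,
-- and straightening an R_c-hit h rewrites it as that interval in increasing order. A hit h′
-- disjoint from h is untouched, and h′ = h becomes increasing, which is right leaning (c ≥ 2
-- as R_c is nonempty). If h′ = L₂L₃ starts inside h = L₁L₂, right leaning of h′ gives a letter
-- of L₂ below a letter of L₃; as the letters of L₃ avoid the interval of h, that interval lies
-- below the one of h′, so L₂ is the top part of the interval of h and lies below all of L₃.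
-- Straightening h thus only sorts L₂ in place, and h′ keeps its letters and stays right leaning.
-- Symmetrically, if h′ = L₁L₂ starts before h = L₂L₃, a letter of L₁ below a letter of L₂
-- forces L₂ to be the bottom part of the interval of h, with all of L₁ below it.

module Submission where

open import Defs
open import Data.Nat using (ℕ; zero; suc; _+_; _∸_; _⊓_; _≤_; _<_; z≤n; s≤s; z<s; _<?_; _≤?_)
open import Data.Nat.Properties
open import Data.Integer as ℤ using (ℤ; +_; +<+; -[1+_])
import Data.Integer.Properties as ℤ
open import Data.List using (List; []; _∷_; take; drop; length; map; _++_; filter; applyUpTo)
open import Data.List.Properties
  using (length-take; length-drop; length-map; length-++; take-[]; take-take; take-drop; drop-drop;
         take-map; drop-map; map-cong-local; map-injective; map-id; map-∘; map-upTo;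
         filter-++; filter-all; filter-none; ++-identityʳ)
open import Data.List.Relation.Unary.All as All using (all?)
open import Data.List.Relation.Unary.Any using (here; there)
open import Data.List.Membership.Propositional using (_∈_; _∉_)
open import Data.List.Membership.Propositional.Properties using (∈-++⁺ˡ; ∈-++⁺ʳ; ∈-++⁻; ∈-map⁺; ∈-map⁻)
open import Data.List.Relation.Binary.Permutation.Propositional using (_↭_; ↭-refl; ↭-sym; ↭-trans; ↭⇒↭ₛ)
open import Data.List.Relation.Binary.Permutation.Propositional.Properties
  using (∈-resp-↭; ↭-length; filter-↭; ++⁺ˡ; ++⁺ʳ) renaming (map⁺ to ↭-map⁺)
open import Data.List.Relation.Unary.Unique.Propositional using (Unique)
open import Data.List.Relation.Unary.AllPairs using (_∷_)
import Data.List.Relation.Unary.Unique.Propositional.Properties as Unique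
open import Data.Product using (∃; _×_; _,_; proj₁; proj₂)
open import Data.Sum using (_⊎_; inj₁; inj₂)
open import Data.Empty using (⊥-elim)
open import Function using (_∘_)
open import Relation.Binary using (tri<; tri≈; tri>; _Preserves_⟶_)
open import Relation.Nullary using (¬_; Dec; yes; no)
open import Relation.Nullary.Decidable using (map′; _×-dec_)
open import Relation.Binary.PropositionalEquality
open import Data.List.Relation.Binary.Permutation.Setoid.Properties (setoid ℕ) using (Unique-resp-↭)

private variable
  A : Set

take-length-++ : ∀ (xs : List A) {ys} → take (length xs) (xs ++ ys) ≡ xs
take-length-++ []       = refl
take-length-++ (x ∷ xs) = cong (x ∷_) (take-length-++ xs)

drop-length-++ : ∀ (xs : List A) {ys} → drop (length xs) (xs ++ ys) ≡ ys
drop-length-++ []       = refl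
drop-length-++ (x ∷ xs) = drop-length-++ xs

take-++-length : ∀ (xs : List A) {ys m} n → length xs ≡ m → take (m + n) (xs ++ ys) ≡ xs ++ take n ys
take-++-length []       n refl = refl
take-++-length (x ∷ xs) n refl = cong (x ∷_) (take-++-length xs n refl)

drop-++-length : ∀ (xs : List A) {ys m} n → length xs ≡ m → drop (m + n) (xs ++ ys) ≡ drop n ys
drop-++-length []       n refl = refl
drop-++-length (x ∷ xs) n refl = drop-++-length xs n refl

take-++-≤ : ∀ (xs : List A) {ys} n → n ≤ length xs → take n (xs ++ ys) ≡ take n xs
take-++-≤ xs       zero    _         = refl
take-++-≤ (x ∷ xs) (suc n) (s≤s n≤) = cong (x ∷_) (take-++-≤ xs n n≤)

drop-++-≤ : ∀ (xs : List A) {ys} n → n ≤ length xs → drop n (xs ++ ys) ≡ drop n xs ++ ys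
drop-++-≤ xs       zero    _         = refl
drop-++-≤ (x ∷ xs) (suc n) (s≤s n≤) = drop-++-≤ xs n n≤

take-+ : ∀ m n (xs : List A) → take (m + n) xs ≡ take m xs ++ take n (drop m xs)
take-+ zero    n xs       = refl
take-+ (suc m) n []       = sym (take-[] n)
take-+ (suc m) n (x ∷ xs) = cong (x ∷_) (take-+ m n xs)

length-take-≤ : ∀ n (xs : List A) → n ≤ length xs → length (take n xs) ≡ n
length-take-≤ n xs n≤ = trans (length-take n xs) (m≤n⇒m⊓n≡m n≤)

disjoint-++ : ∀ (xs : List A) {ys z} → Unique (xs ++ ys) → z ∈ xs → z ∉ ys
disjoint-++ (x ∷ xs) (x∉ ∷ _)  (here refl) z∈ys = All.lookup x∉ (∈-++⁺ʳ xs z∈ys) refl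
disjoint-++ (x ∷ xs) (_ ∷ !xs) (there z∈xs) z∈ys = disjoint-++ xs !xs z∈xs z∈ys

unique-++ʳ : ∀ (xs : List A) {ys} → Unique (xs ++ ys) → Unique ys
unique-++ʳ xs = subst Unique (drop-length-++ xs) ∘ Unique.drop⁺ (length xs)

disjoint-++-++ : ∀ (xs ys : List A) {zs z} → Unique (xs ++ ys ++ zs) → z ∈ zs → z ∉ xs ++ ys
disjoint-++-++ xs ys !L z∈zs z∈ with ∈-++⁻ xs z∈
... | inj₁ z∈xs = disjoint-++ xs !L z∈xs (∈-++⁺ʳ ys z∈zs)
... | inj₂ z∈ys = disjoint-++ ys (unique-++ʳ xs !L) z∈ys z∈zs

sub-+ : ∀ w p m n → sub w p (m + n) ≡ sub w p m ++ sub w (p + m) n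
sub-+ w p m n = trans (take-+ m n (drop p w)) (cong (λ z → sub w p m ++ take n z) (drop-drop p m w))

length-sub : ∀ w p n → p + n ≤ length w → length (sub w p n) ≡ n
length-sub w p n bound =
  length-take-≤ n (drop p w)
    (subst (n ≤_) (sym (length-drop p w)) (m+n≤o⇒m≤o∸n n (subst (_≤ length w) (+-comm p n) bound)))

unique-sub : ∀ {w} p n → Unique w → Unique (sub w p n)
unique-sub p n = Unique.take⁺ n ∘ Unique.drop⁺ p

-- Intervals

interval : ℕ → ℕ → List ℕ
interval a zero    = []
interval a (suc c) = a ∷ interval (suc a) c

length-interval : ∀ a c → length (interval a c) ≡ c
length-interval a zero    = refl
length-interval a (suc c) = cong suc (length-interval (suc a) c)

∈-interval⁻ : ∀ {z} a c → z ∈ interval a c → a ≤ z × z < a + c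
∈-interval⁻ a (suc c) (here refl) = ≤-refl , m<m+n a z<s
∈-interval⁻ {z} a (suc c) (there z∈) with ∈-interval⁻ (suc a) c z∈
... | a<z , z< = <⇒≤ a<z , subst (z <_) (sym (+-suc a c)) z<

∈-interval⁺ : ∀ {z} a c → a ≤ z → z < a + c → z ∈ interval a c
∈-interval⁺ {z} a zero    a≤z z< =
  ⊥-elim (<-irrefl refl (<-≤-trans z< (subst (_≤ z) (sym (+-identityʳ a)) a≤z)))
∈-interval⁺ {z} a (suc c) a≤z z< with m≤n⇒m<n∨m≡n a≤z
... | inj₂ refl = here refl
... | inj₁ a<z  = there (∈-interval⁺ (suc a) c a<z (subst (z <_) (+-suc a c) z<))

∉-interval : ∀ {z} a c → z ∉ interval a c → z < a ⊎ a + c ≤ z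
∉-interval {z} a c z∉ with z <? a | z <? a + c
... | yes z<a | _        = inj₁ z<a
... | no z≮a  | yes z<   = ⊥-elim (z∉ (∈-interval⁺ a c (≮⇒≥ z≮a) z<))
... | no _    | no z≮    = inj₂ (≮⇒≥ z≮)

interval-+ : ∀ a m n → interval a (m + n) ≡ interval a m ++ interval (a + m) n
interval-+ a zero    n = cong (λ b → interval b n) (sym (+-identityʳ a))
interval-+ a (suc m) n = cong (a ∷_)
  (trans (interval-+ (suc a) m n) (cong (λ b → interval (suc a) m ++ interval b n) (sym (+-suc a m))))

interval-split : ∀ {a m} c → a ≤ m → m ≤ a + c
  → interval a c ≡ interval a (m ∸ a) ++ interval m (a + c ∸ m)
interval-split {a} {m} c a≤m m≤ = begin
  interval a c                                                ≡⟨ cong (interval a) (m+[n∸m]≡n split≤c) ⟨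
  interval a ((m ∸ a) + (c ∸ (m ∸ a)))                        ≡⟨ interval-+ a (m ∸ a) (c ∸ (m ∸ a)) ⟩
  interval a (m ∸ a) ++ interval (a + (m ∸ a)) (c ∸ (m ∸ a))  ≡⟨ cong₂ (λ b k → interval a (m ∸ a) ++ interval b k)
                                                                       (m+[n∸m]≡n a≤m) rest ⟩
  interval a (m ∸ a) ++ interval m (a + c ∸ m)                ∎
  where
  open ≡-Reasoning
  split≤c : m ∸ a ≤ c
  split≤c = subst (m ∸ a ≤_) (m+n∸m≡n a c) (∸-monoˡ-≤ a m≤)
  rest : c ∸ (m ∸ a) ≡ a + c ∸ m
  rest = trans (sym ([m+n]∸[m+o]≡n∸o a c (m ∸ a))) (cong (a + c ∸_) (m+[n∸m]≡n a≤m))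

applyUpTo-interval : ∀ {f} a c → (∀ x → f x ≡ a + x) → applyUpTo f c ≡ interval a c
applyUpTo-interval a zero    f≗ = refl
applyUpTo-interval a (suc c) f≗ =
  cong₂ _∷_ (trans (f≗ 0) (+-identityʳ a))
            (applyUpTo-interval (suc a) c (λ x → trans (f≗ (suc x)) (+-suc a x)))

range1≡interval : ∀ c → range1 c ≡ interval 1 c
range1≡interval c = trans (map-upTo suc c) (applyUpTo-interval 1 c (λ _ → refl))

∈-↭-interval : ∀ {xs z a c} → xs ↭ interval a c → z ∈ xs → a ≤ z × z < a + c
∈-↭-interval {a = a} {c} xs↭ z∈ = ∈-interval⁻ a c (∈-resp-↭ xs↭ z∈)

↭-interval-split : ∀ {xs ys a m} c → xs ++ ys ↭ interval a c → a ≤ m → m ≤ a + c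
  → (∀ {z} → z ∈ xs → z < m) → (∀ {z} → z ∈ ys → m ≤ z)
  → xs ↭ interval a (m ∸ a) × ys ↭ interval m (a + c ∸ m)
↭-interval-split {xs} {ys} {a} {m} c xys↭ a≤m m≤ xs<m m≤ys =
  subst₂ _↭_ (proj₁ split-xys) (proj₁ split-interval) (filter-↭ (_<? m) xys↭′)
  , subst₂ _↭_ (proj₂ split-xys) (proj₂ split-interval) (filter-↭ (m ≤?_) xys↭′)
  where
  separate : ∀ (us vs : List ℕ) → (∀ {z} → z ∈ us → z < m) → (∀ {z} → z ∈ vs → m ≤ z)
    → filter (_<? m) (us ++ vs) ≡ us × filter (m ≤?_) (us ++ vs) ≡ vs
  separate us vs us<m m≤vs =
      trans (filter-++ (_<? m) us vs)
        (trans (cong₂ _++_ (filter-all (_<? m) (All.tabulate us<m))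
                           (filter-none (_<? m) (All.tabulate (≤⇒≯ ∘ m≤vs))))
               (++-identityʳ us))
    , trans (filter-++ (m ≤?_) us vs)
        (cong₂ _++_ (filter-none (m ≤?_) (All.tabulate (<⇒≱ ∘ us<m)))
                    (filter-all (m ≤?_) (All.tabulate m≤vs)))
  xys↭′ = subst (xs ++ ys ↭_) (interval-split c a≤m m≤) xys↭
  split-xys = separate xs ys xs<m m≤ys
  split-interval = separate (interval a (m ∸ a)) (interval m (a + c ∸ m))
    (λ z∈ → subst (_ <_) (m+[n∸m]≡n a≤m) (proj₂ (∈-interval⁻ a (m ∸ a) z∈)))
    (λ z∈ → proj₁ (∈-interval⁻ m (a + c ∸ m) z∈))

shift : ℤ → ℕ → ℤ
shift k x = + x ℤ.+ k

shift-interval : ∀ {a} k s c → + a ≡ shift k s → map (shift k) (interval s c) ≡ map +_ (interval a c)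
shift-interval     k s zero    _ = refl
shift-interval {a} k s (suc c) e = cong₂ _∷_ (sym e) (shift-interval k (suc s) c (begin
  + suc a                ≡⟨ cong (ℤ._+_ (+ 1)) e ⟩
  + 1 ℤ.+ (+ s ℤ.+ k)    ≡⟨ ℤ.+-assoc (+ 1) (+ s) k ⟨
  shift k (suc s)        ∎))
  where open ≡-Reasoning

forms-offset : ∀ {v u s} k → map +_ v ≡ map (shift k) u → s ∈ u → ∃ λ a → + a ≡ shift k s
forms-offset k eq s∈u with ∈-map⁻ +_ (subst (_ ∈_) (sym eq) (∈-map⁺ (shift k) s∈u))
... | a , _ , e = a , sym e

↭-map-+⁻ : ∀ {xs ys} → map +_ xs ↭ map +_ ys → xs ↭ ys
↭-map-+⁻ {xs} {ys} p = subst₂ _↭_ (unmap xs) (unmap ys) (↭-map⁺ ℤ.∣_∣ p)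
  where
  unmap : ∀ zs → map ℤ.∣_∣ (map +_ zs) ≡ zs
  unmap zs = trans (sym (map-∘ zs)) (map-id zs)

1∈interval : ∀ c → 1 ≤ c → 1 ∈ interval 1 c
1∈interval c c≥1 = ∈-interval⁺ 1 c ≤-refl (s≤s c≥1)

forms⇒↭interval : ∀ {v u c} → 1 ≤ c → IsPerm c u → Forms v u → ∃ λ a → v ↭ interval a c
forms⇒↭interval {v} {u} {c} c≥1 u↭ (k , eq) =
  a , ↭-map-+⁻ (subst₂ _↭_ (sym eq) (shift-interval k 1 c (proj₂ offset)) (↭-map⁺ (shift k) u↭′))
  where
  u↭′ = subst (u ↭_) (range1≡interval c) u↭
  offset = forms-offset k eq (∈-resp-↭ (↭-sym u↭′) (1∈interval c c≥1))
  a = proj₁ offset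

forms-range1⇒interval : ∀ {v c} → 1 ≤ c → Forms v (range1 c) → ∃ λ a → v ≡ interval a c
forms-range1⇒interval {v} {c} c≥1 (k , eq)
  with forms-offset k eq (subst (1 ∈_) (sym (range1≡interval c)) (1∈interval c c≥1))
... | a , e = a , map-injective ℤ.+-injective
  (trans eq (trans (cong (map (shift k)) (range1≡interval c)) (shift-interval k 1 c e)))

forms-length : ∀ {v u} → Forms v u → length v ≡ length u
forms-length {v} {u} (k , eq) =
  trans (sym (length-map +_ v)) (trans (cong length eq) (length-map (shift k) u))

-- Right leaning

reflects-< : ∀ {f : ℕ → ℤ} {x y} → f Preserves _<_ ⟶ ℤ._<_ → f x ℤ.< f y → x < y
reflects-< {x = x} {y} f-mono fx<fy with <-cmp x y
... | tri< x<y _ _ = x<y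
... | tri≈ _ refl _ = ⊥-elim (ℤ.<-irrefl refl fx<fy)
... | tri> _ _ y<x = ⊥-elim (ℤ.<-asym fx<fy (f-mono y<x))

∈-map-≡ : ∀ {f g : ℕ → ℤ} {xs ys x} → map f xs ≡ map g ys → x ∈ xs → ∃ λ y → y ∈ ys × f x ≡ g y
∈-map-≡ {f} eq x∈ = ∈-map⁻ _ (subst (_ ∈_) eq (∈-map⁺ f x∈))

firstAreSmallest-transport : ∀ {f g : ℕ → ℤ} {v u t}
  → f Preserves _<_ ⟶ ℤ._<_ → g Preserves _<_ ⟶ ℤ._<_
  → map f v ≡ map g u → FirstAreSmallest u t → FirstAreSmallest v t
firstAreSmallest-transport {f} {g} {v} {u} {t} f-mono g-mono eq fas x y x∈ y∈
  with ∈-map-≡ front x∈ | ∈-map-≡ back y∈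
  where
  front : map f (take t v) ≡ map g (take t u)
  front = trans (sym (take-map t v)) (trans (cong (take t) eq) (take-map t u))
  back : map f (drop t v) ≡ map g (drop t u)
  back = trans (sym (drop-map t v)) (trans (cong (drop t) eq) (drop-map t u))
... | x′ , x′∈ , fx≡ | y′ , y′∈ , fy≡ =
  reflects-< f-mono (subst₂ ℤ._<_ (sym fx≡) (sym fy≡) (g-mono (fas x′ y′ x′∈ y′∈)))

shift-mono : ∀ k → shift k Preserves _<_ ⟶ ℤ._<_
shift-mono k x<y = ℤ.+-monoˡ-< k (+<+ x<y)

rightLeaning-transport : ∀ {v u} → (∀ {t} → FirstAreSmallest u t → FirstAreSmallest v t)
  → (∀ {t} → FirstAreSmallest v t → FirstAreSmallest u t) → length u ≡ length v
  → RightLeaning u → RightLeaning v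
rightLeaning-transport to from len (t , (t≥1 , fas , minimal) , t<) =
  t , (t≥1 , to fas , λ k k≥1 k<t → minimal k k≥1 k<t ∘ from) , subst (t <_) len t<

forms-rightLeaning : ∀ {v u} → Forms v u → RightLeaning u → RightLeaning v
forms-rightLeaning {v} {u} f@(k , eq) = rightLeaning-transport
  (firstAreSmallest-transport +<+ (shift-mono k) eq)
  (firstAreSmallest-transport (shift-mono k) +<+ (sym eq))
  (sym (forms-length f))

forms-rightLeaning⁻ : ∀ {v u} → Forms v u → RightLeaning v → RightLeaning u
forms-rightLeaning⁻ {v} {u} f@(k , eq) = rightLeaning-transport
  (firstAreSmallest-transport (shift-mono k) +<+ (sym eq))
  (firstAreSmallest-transport +<+ (shift-mono k) eq)
  (forms-length f)

firstAreSmallest? : ∀ w t → Dec (FirstAreSmallest w t)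
firstAreSmallest? w t = map′ (λ a x y x∈ y∈ → All.lookup (All.lookup a x∈) y∈)
                             (λ fas → All.tabulate λ x∈ → All.tabulate λ y∈ → fas _ _ x∈ y∈)
                             (all? (λ x → all? (x <?_) (drop t w)) (take t w))

least-witness : ∀ {P : ℕ → Set} → (∀ n → Dec (P n)) → ∀ n → ∃ (λ k → k ≤ n × P k)
  → ∃ λ m → m ≤ n × P m × (∀ k → k < m → ¬ P k)
least-witness P? n (k , k≤n , Pk) with anyUpTo? P? n
least-witness P? n       (k , k≤n , Pk) | no ¬below =
  k , k≤n , Pk , λ j j<k Pj → ¬below (j , <-≤-trans j<k k≤n , Pj)
least-witness P? zero    _              | yes (_ , () , _)
least-witness P? (suc n) _              | yes (j , s≤s j≤n , Pj) with least-witness P? n (j , j≤n , Pj)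
... | m , m≤n , Pm , below = m , m≤n⇒m≤1+n m≤n , Pm , below

rightLeaning-intro : ∀ {w t} → 1 ≤ t → t < length w → FirstAreSmallest w t → RightLeaning w
rightLeaning-intro {w} {suc t} _ t< fas
  with least-witness (λ k → firstAreSmallest? w (suc k)) t (t , ≤-refl , fas)
... | m , m≤t , fas-m , below = suc m , (s≤s z≤n , fas-m , minimal) , ≤-<-trans (s≤s m≤t) t<
  where
  minimal : ∀ k → 1 ≤ k → k < suc m → ¬ FirstAreSmallest w k
  minimal (suc k) _ (s≤s k<m) = below k k<m

rightLeaning? : ∀ w → Dec (RightLeaning w)
rightLeaning? w with anyUpTo? (λ t → (1 ≤? t) ×-dec firstAreSmallest? w t) (length w)
... | yes (t , t< , t≥1 , fas) = yes (rightLeaning-intro t≥1 t< fas)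
... | no ¬∃ = no λ { (t , (t≥1 , fas , _) , t<) → ¬∃ (t , t< , t≥1 , fas) }

nonempty : ∀ {x : A} {xs} → x ∈ xs → 1 ≤ length xs
nonempty {xs = _ ∷ _} _ = s≤s z≤n

rightLeaning-++ : ∀ {xs ys x y} → x ∈ xs → y ∈ ys → (∀ {x y} → x ∈ xs → y ∈ ys → x < y)
  → RightLeaning (xs ++ ys)
rightLeaning-++ {xs} {ys} x∈ y∈ xs<ys = rightLeaning-intro (nonempty x∈) xs<xs++ys separated
  where
  xs<xs++ys : length xs < length (xs ++ ys)
  xs<xs++ys = subst (length xs <_) (sym (length-++ xs)) (m<m+n (length xs) (nonempty y∈))
  separated : FirstAreSmallest (xs ++ ys) (length xs)
  separated x y x∈′ y∈′ =
    xs<ys (subst (x ∈_) (take-length-++ xs) x∈′) (subst (y ∈_) (drop-length-++ xs) y∈′)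

drop-meets : ∀ {ys : List A} t → t < length ys → ∃ λ y → y ∈ ys × y ∈ drop t ys
drop-meets {ys = y ∷ ys} zero    _       = y , here refl , here refl
drop-meets {ys = y ∷ ys} (suc t) (s≤s t<) with drop-meets t t<
... | z , z∈ , z∈drop = z , there z∈ , z∈drop

drop-meets-suffix : ∀ (xs : List A) {ys} t → t < length (xs ++ ys) → 1 ≤ length ys
  → ∃ λ y → y ∈ ys × y ∈ drop t (xs ++ ys)
drop-meets-suffix []       t       t<       _    = drop-meets t t<
drop-meets-suffix (x ∷ xs) (suc t) (s≤s t<) ys≥1 = drop-meets-suffix xs t t< ys≥1
drop-meets-suffix (x ∷ xs) {y ∷ ys} zero _  _    = y , here refl , ∈-++⁺ʳ (x ∷ xs) (here refl)

rightLeaning-++⁻ : ∀ {xs ys} → 1 ≤ length xs → 1 ≤ length ys → RightLeaning (xs ++ ys)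
  → ∃ λ x → ∃ λ y → x ∈ xs × y ∈ ys × x < y
rightLeaning-++⁻ {x ∷ xs} {ys} _ ys≥1 (suc t , (_ , fas , _) , t<)
  with drop-meets-suffix (x ∷ xs) (suc t) t< ys≥1
... | y , y∈ , y∈drop = x , y , here refl , y∈ , fas x y (here refl) y∈drop

normalise : ℕ → ℕ → ℕ
normalise b x = suc (x ∸ b)

normalise-interval : ∀ {b} a c → b ≤ a → map (normalise b) (interval a c) ≡ interval (suc (a ∸ b)) c
normalise-interval     a zero    _   = refl
normalise-interval {b} a (suc c) b≤a = cong (suc (a ∸ b) ∷_)
  (trans (normalise-interval (suc a) c (m≤n⇒m≤1+n b≤a))
         (cong (λ z → interval (suc z) c) (+-∸-assoc 1 b≤a)))

interval-normalise : ∀ {X b c} → X ↭ interval b c → ∃ λ u → IsPerm c u × Forms X u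
interval-normalise {X} {b} {c} X↭ = map (normalise b) X , perm , k , forms
  where
  k = -[1+ 0 ] ℤ.+ + b
  perm : IsPerm c (map (normalise b) X)
  perm = subst (map (normalise b) X ↭_)
    (trans (normalise-interval b c ≤-refl)
           (trans (cong (λ z → interval (suc z) c) (n∸n≡0 b)) (sym (range1≡interval c))))
    (↭-map⁺ (normalise b) X↭)
  pointwise : ∀ {x} → x ∈ X → + x ≡ shift k (normalise b x)
  pointwise {x} x∈ = trans (cong +_ (sym (m∸n+n≡m (proj₁ (∈-↭-interval X↭ x∈)))))
                           (ℤ.+-assoc (+ normalise b x) -[1+ 0 ] (+ b))
  forms : map +_ X ≡ map (shift k) (map (normalise b) X)
  forms = trans (map-cong-local (All.tabulate pointwise)) (map-∘ X)

-- X forms a permutation in R_c, phrased via the letters of X rather than a witness u ∈ R_c.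
FormsR : ℕ → List ℕ → Set
FormsR c X = (∃ λ b → X ↭ interval b c) × RightLeaning X

rhit⇒formsR : ∀ {w i c} → 1 ≤ c → RHit w i c → FormsR c (sub w i c)
rhit⇒formsR c≥1 (_ , u , (u-perm , u-leaning) , forms) =
  forms⇒↭interval c≥1 u-perm forms , forms-rightLeaning forms u-leaning

formsR⇒rhit : ∀ {w i c} → i + c ≤ length w → FormsR c (sub w i c) → RHit w i c
formsR⇒rhit bound ((b , X↭) , leaning) with interval-normalise X↭
... | u , u-perm , forms = bound , u , (u-perm , forms-rightLeaning⁻ forms leaning) , forms

rhit? : ∀ {w i c} → 1 ≤ c → SHit w i c → Dec (RHit w i c)
rhit? {w} {i} {c} c≥1 (bound , u , u-perm , forms) with rightLeaning? (sub w i c)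
... | yes leaning = yes (formsR⇒rhit bound (forms⇒↭interval c≥1 u-perm forms , leaning))
... | no ¬leaning = no (¬leaning ∘ proj₂ ∘ rhit⇒formsR c≥1)

splice : List ℕ → ℕ → ℕ → List ℕ → List ℕ
splice w i c v = take i w ++ v ++ drop (i + c) w

length-splice : ∀ w v i c → length v ≡ c → i + c ≤ length w → length (splice w i c v) ≡ length w
length-splice w v i c lv bound = begin
  length (take i w ++ v ++ rest)               ≡⟨ length-++ (take i w) ⟩
  length (take i w) + length (v ++ rest)       ≡⟨ cong₂ _+_ (length-take-≤ i w (m+n≤o⇒m≤o i bound)) (length-++ v) ⟩
  i + (length v + length rest)                 ≡⟨ cong₂ (λ m n → i + (m + n)) lv (length-drop (i + c) w) ⟩
  i + (c + (length w ∸ (i + c)))               ≡⟨ +-assoc i c _ ⟨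
  i + c + (length w ∸ (i + c))                 ≡⟨ m+[n∸m]≡n bound ⟩
  length w                                     ∎
  where
  open ≡-Reasoning
  rest = drop (i + c) w

sub-splice-overlapʳ : ∀ w v i c d → length v ≡ c → i ≤ length w → d ≤ c
  → sub (splice w i c v) (i + d) c ≡ drop d v ++ sub w (i + c) d
sub-splice-overlapʳ w v i c d lv i≤ d≤c = begin
  take c (drop (i + d) (take i w ++ v ++ rest))
    ≡⟨ cong (take c) (drop-++-length (take i w) d (length-take-≤ i w i≤)) ⟩
  take c (drop d (v ++ rest))
    ≡⟨ cong (take c) (drop-++-≤ v d (subst (d ≤_) (sym lv) d≤c)) ⟩
  take c (drop d v ++ rest)
    ≡⟨ cong (λ n → take n (drop d v ++ rest)) (m∸n+n≡m d≤c) ⟨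
  take (c ∸ d + d) (drop d v ++ rest)
    ≡⟨ take-++-length (drop d v) d (trans (length-drop d v) (cong (_∸ d) lv)) ⟩
  drop d v ++ take d rest
    ∎
  where
  open ≡-Reasoning
  rest = drop (i + c) w

sub-splice-overlapˡ : ∀ w v j c d → length v ≡ c → j + d ≤ length w → d ≤ c
  → sub (splice w (j + d) c v) j c ≡ sub w j d ++ take (c ∸ d) v
sub-splice-overlapˡ w v j c d lv bound d≤c = begin
  take c (drop j (take (j + d) w ++ v ++ rest))
    ≡⟨ cong (take c) (drop-++-≤ (take (j + d) w) j j≤) ⟩
  take c (drop j (take (j + d) w) ++ v ++ rest)
    ≡⟨ cong (λ z → take c (z ++ v ++ rest)) (take-drop d j w) ⟨
  take c (sub w j d ++ v ++ rest)
    ≡⟨ cong (λ n → take n (sub w j d ++ v ++ rest)) (m+[n∸m]≡n d≤c) ⟨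
  take (d + (c ∸ d)) (sub w j d ++ v ++ rest)
    ≡⟨ take-++-length (sub w j d) (c ∸ d) (length-sub w j d bound) ⟩
  sub w j d ++ take (c ∸ d) (v ++ rest)
    ≡⟨ cong (sub w j d ++_) (take-++-≤ v (c ∸ d) (subst (c ∸ d ≤_) (sym lv) (m∸n≤m c d))) ⟩
  sub w j d ++ take (c ∸ d) v
    ∎
  where
  open ≡-Reasoning
  rest = drop (j + d + c) w
  j≤ : j ≤ length (take (j + d) w)
  j≤ = subst (j ≤_) (sym (length-take-≤ (j + d) w bound)) (m≤m+n j d)

sub-splice-self : ∀ w v i c → length v ≡ c → i ≤ length w → sub (splice w i c v) i c ≡ v
sub-splice-self w v i c lv i≤ =
  trans (cong (λ p → sub (splice w i c v) p c) (sym (+-identityʳ i)))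
        (trans (sub-splice-overlapʳ w v i c 0 lv i≤ z≤n) (++-identityʳ v))

sub-splice-before : ∀ w v i c e → length v ≡ c → i ≤ length w
  → sub (splice w i c v) (i + c + e) c ≡ sub w (i + c + e) c
sub-splice-before w v i c e lv i≤ = cong (take c) (begin
  drop (i + c + e) (take i w ++ v ++ rest)    ≡⟨ cong (λ n → drop n (take i w ++ v ++ rest)) (+-assoc i c e) ⟩
  drop (i + (c + e)) (take i w ++ v ++ rest)  ≡⟨ drop-++-length (take i w) (c + e) (length-take-≤ i w i≤) ⟩
  drop (c + e) (v ++ rest)                    ≡⟨ drop-++-length v e lv ⟩
  drop e rest                                 ≡⟨ drop-drop (i + c) e w ⟩
  drop (i + c + e) w                          ∎)
  where
  open ≡-Reasoning
  rest = drop (i + c) w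

sub-splice-after : ∀ w v j c e → j + c + e ≤ length w → sub (splice w (j + c + e) c v) j c ≡ sub w j c
sub-splice-after w v j c e i≤ = begin
  take c (drop j (splice w i c v))        ≡⟨ take-drop c j (splice w i c v) ⟩
  drop j (take (j + c) (splice w i c v))  ≡⟨ cong (drop j) prefix ⟩
  drop j (take (j + c) w)                 ≡⟨ take-drop c j w ⟨
  take c (drop j w)                       ∎
  where
  open ≡-Reasoning
  i = j + c + e
  j+c≤i = m≤m+n (j + c) e
  prefix : take (j + c) (splice w i c v) ≡ take (j + c) w
  prefix = begin
    take (j + c) (take i w ++ _)  ≡⟨ take-++-≤ (take i w) (j + c) (subst (j + c ≤_) (sym (length-take-≤ i w i≤)) j+c≤i) ⟩
    take (j + c) (take i w)       ≡⟨ take-take (j + c) i w ⟩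
    take ((j + c) ⊓ i) w          ≡⟨ cong (λ n → take n w) (m≤n⇒m⊓n≡m j+c≤i) ⟩
    take (j + c) w                ∎

module Windows (w : List ℕ) (p d c : ℕ) (d≤c : d ≤ c) (bound : p + d + c ≤ length w) where

  L₁ L₂ L₃ : List ℕ
  L₁ = sub w p d
  L₂ = sub w (p + d) (c ∸ d)
  L₃ = sub w (p + c) d

  first-window : sub w p c ≡ L₁ ++ L₂
  first-window = trans (cong (sub w p) (sym (m+[n∸m]≡n d≤c))) (sub-+ w p d (c ∸ d))

  second-window : sub w (p + d) c ≡ L₂ ++ L₃
  second-window = begin
    sub w (p + d) c                  ≡⟨ cong (sub w (p + d)) (m∸n+n≡m d≤c) ⟨
    sub w (p + d) (c ∸ d + d)        ≡⟨ sub-+ w (p + d) (c ∸ d) d ⟩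
    L₂ ++ sub w (p + d + (c ∸ d)) d  ≡⟨ cong (λ q → L₂ ++ sub w q d) p+d+[c∸d]≡p+c ⟩
    L₂ ++ L₃                         ∎
    where
    open ≡-Reasoning
    p+d+[c∸d]≡p+c : p + d + (c ∸ d) ≡ p + c
    p+d+[c∸d]≡p+c = trans (+-assoc p d (c ∸ d)) (cong (_+_ p) (m+[n∸m]≡n d≤c))

  unique-blocks : Unique w → Unique (L₁ ++ L₂ ++ L₃)
  unique-blocks !w =
    subst Unique (trans (sub-+ w p d c) (cong (L₁ ++_) second-window)) (unique-sub p (d + c) !w)

  length-L₁ : length L₁ ≡ d
  length-L₁ = length-sub w p d (m+n≤o⇒m≤o (p + d) bound)

  length-L₂ : length L₂ ≡ c ∸ d
  length-L₂ = length-sub w (p + d) (c ∸ d) (≤-trans (+-monoʳ-≤ (p + d) (m∸n≤m c d)) bound)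

  length-L₃ : length L₃ ≡ d
  length-L₃ = length-sub w (p + c) d (subst (_≤ length w) p+d+c≡p+c+d bound)
    where
    p+d+c≡p+c+d : p + d + c ≡ p + c + d
    p+d+c≡p+c+d = trans (+-assoc p d c) (trans (cong (_+_ p) (+-comm d c)) (sym (+-assoc p c d)))

-- Overlapping hits

formsR-sort-overlapʳ : ∀ L₁ L₂ L₃ {a c} → Unique (L₁ ++ L₂ ++ L₃) → L₁ ++ L₂ ↭ interval a c
  → 1 ≤ length L₂ → 1 ≤ length L₃ → FormsR c (L₂ ++ L₃)
  → FormsR c (drop (length L₁) (interval a c) ++ L₃)
formsR-sort-overlapʳ L₁ L₂ L₃ {a} {c} !L h↭ L₂≥1 L₃≥1 ((b , h′↭) , leaning)
  with rightLeaning-++⁻ L₂≥1 L₃≥1 leaning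
... | x , y , x∈ , y∈ , x<y = subst (λ P → FormsR c (P ++ L₃)) (sym dropped) ((b , perm) , leaning′)
  where
  inh : ∀ {z} → z ∈ L₁ ++ L₂ → a ≤ z × z < a + c
  inh = ∈-↭-interval h↭
  inh′ : ∀ {z} → z ∈ L₂ ++ L₃ → b ≤ z × z < b + c
  inh′ = ∈-↭-interval h′↭
  L₃∉h : ∀ {z} → z ∈ L₃ → z ∉ interval a c
  L₃∉h z∈ = disjoint-++-++ L₁ L₂ !L z∈ ∘ ∈-resp-↭ (↭-sym h↭)
  L₁∉h′ : ∀ {z} → z ∈ L₁ → z ∉ interval b c
  L₁∉h′ z∈ = disjoint-++ L₁ !L z∈ ∘ ∈-resp-↭ (↭-sym h′↭)
  a<b : a < b
  a<b with ∉-interval a c (L₃∉h y∈)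
  ... | inj₁ y<a   = ⊥-elim (<-asym y<a (≤-<-trans (proj₁ (inh (∈-++⁺ʳ L₁ x∈))) x<y))
  ... | inj₂ a+c≤y = +-cancelʳ-< c a b (≤-<-trans a+c≤y (proj₂ (inh′ (∈-++⁺ʳ L₂ y∈))))
  L₁<b : ∀ {z} → z ∈ L₁ → z < b
  L₁<b z∈ with ∉-interval b c (L₁∉h′ z∈)
  ... | inj₁ z<b   = z<b
  ... | inj₂ b+c≤z = ⊥-elim (<-asym (proj₂ (inh (∈-++⁺ˡ z∈))) (<-≤-trans (+-monoˡ-< c a<b) b+c≤z))
  a+c≤L₃ : ∀ {z} → z ∈ L₃ → a + c ≤ z
  a+c≤L₃ z∈ with ∉-interval a c (L₃∉h z∈)
  ... | inj₁ z<a   = ⊥-elim (<-asym z<a (<-≤-trans a<b (proj₁ (inh′ (∈-++⁺ʳ L₂ z∈)))))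
  ... | inj₂ a+c≤z = a+c≤z
  b≤a+c = <⇒≤ (≤-<-trans (proj₁ (inh′ (∈-++⁺ˡ x∈))) (proj₂ (inh (∈-++⁺ʳ L₁ x∈))))
  split = ↭-interval-split c h↭ (<⇒≤ a<b) b≤a+c L₁<b (λ z∈ → proj₁ (inh′ (∈-++⁺ˡ z∈)))
  dropped : drop (length L₁) (interval a c) ≡ interval b (a + c ∸ b)
  dropped = begin
    drop (length L₁) (interval a c)
      ≡⟨ cong₂ drop (↭-length (proj₁ split)) (interval-split c (<⇒≤ a<b) b≤a+c) ⟩
    drop (length (interval a (b ∸ a))) (interval a (b ∸ a) ++ interval b (a + c ∸ b))
      ≡⟨ drop-length-++ (interval a (b ∸ a)) ⟩
    interval b (a + c ∸ b)
      ∎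
    where open ≡-Reasoning
  perm : interval b (a + c ∸ b) ++ L₃ ↭ interval b c
  perm = ↭-trans (++⁺ʳ L₃ (↭-sym (proj₂ split))) h′↭
  leaning′ : RightLeaning (interval b (a + c ∸ b) ++ L₃)
  leaning′ = rightLeaning-++ (∈-resp-↭ (proj₂ split) x∈) y∈ λ {z} z∈ z′∈ →
    <-≤-trans (subst (z <_) (m+[n∸m]≡n b≤a+c) (proj₂ (∈-interval⁻ b (a + c ∸ b) z∈))) (a+c≤L₃ z′∈)

formsR-sort-overlapˡ : ∀ L₁ L₂ L₃ {a c} → Unique (L₁ ++ L₂ ++ L₃) → L₂ ++ L₃ ↭ interval a c
  → 1 ≤ length L₁ → 1 ≤ length L₂ → FormsR c (L₁ ++ L₂)
  → FormsR c (L₁ ++ take (length L₂) (interval a c))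
formsR-sort-overlapˡ L₁ L₂ L₃ {a} {c} !L h↭ L₁≥1 L₂≥1 ((b , h′↭) , leaning)
  with rightLeaning-++⁻ L₁≥1 L₂≥1 leaning
... | x , y , x∈ , y∈ , x<y = subst (λ P → FormsR c (L₁ ++ P)) (sym taken) ((b , perm) , leaning′)
  where
  inh : ∀ {z} → z ∈ L₂ ++ L₃ → a ≤ z × z < a + c
  inh = ∈-↭-interval h↭
  inh′ : ∀ {z} → z ∈ L₁ ++ L₂ → b ≤ z × z < b + c
  inh′ = ∈-↭-interval h′↭
  L₁∉h : ∀ {z} → z ∈ L₁ → z ∉ interval a c
  L₁∉h z∈ = disjoint-++ L₁ !L z∈ ∘ ∈-resp-↭ (↭-sym h↭)
  L₃∉h′ : ∀ {z} → z ∈ L₃ → z ∉ interval b c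
  L₃∉h′ z∈ = disjoint-++-++ L₁ L₂ !L z∈ ∘ ∈-resp-↭ (↭-sym h′↭)
  b<a : b < a
  b<a with ∉-interval a c (L₁∉h x∈)
  ... | inj₁ x<a   = ≤-<-trans (proj₁ (inh′ (∈-++⁺ˡ x∈))) x<a
  ... | inj₂ a+c≤x = ⊥-elim (<-asym (proj₂ (inh (∈-++⁺ˡ y∈))) (≤-<-trans a+c≤x x<y))
  L₁<a : ∀ {z} → z ∈ L₁ → z < a
  L₁<a z∈ with ∉-interval a c (L₁∉h z∈)
  ... | inj₁ z<a   = z<a
  ... | inj₂ a+c≤z = ⊥-elim (<-asym (proj₂ (inh′ (∈-++⁺ˡ z∈))) (<-≤-trans (+-monoˡ-< c b<a) a+c≤z))
  b+c≤L₃ : ∀ {z} → z ∈ L₃ → b + c ≤ z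
  b+c≤L₃ z∈ with ∉-interval b c (L₃∉h′ z∈)
  ... | inj₁ z<b   = ⊥-elim (<-asym z<b (<-≤-trans b<a (proj₁ (inh (∈-++⁺ʳ L₂ z∈)))))
  ... | inj₂ b+c≤z = b+c≤z
  a≤b+c = <⇒≤ (≤-<-trans (proj₁ (inh (∈-++⁺ˡ y∈))) (proj₂ (inh′ (∈-++⁺ʳ L₁ y∈))))
  b+c≤a+c = +-monoˡ-≤ c (<⇒≤ b<a)
  split = ↭-interval-split c h↭ a≤b+c b+c≤a+c (λ z∈ → proj₂ (inh′ (∈-++⁺ʳ L₁ z∈))) b+c≤L₃
  taken : take (length L₂) (interval a c) ≡ interval a (b + c ∸ a)
  taken = begin
    take (length L₂) (interval a c)
      ≡⟨ cong₂ take (↭-length (proj₁ split)) (interval-split c a≤b+c b+c≤a+c) ⟩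
    take (length (interval a (b + c ∸ a))) (interval a (b + c ∸ a) ++ interval (b + c) (a + c ∸ (b + c)))
      ≡⟨ take-length-++ (interval a (b + c ∸ a)) ⟩
    interval a (b + c ∸ a)
      ∎
    where open ≡-Reasoning
  perm : L₁ ++ interval a (b + c ∸ a) ↭ interval b c
  perm = ↭-trans (++⁺ˡ L₁ (↭-sym (proj₁ split))) h′↭
  leaning′ : RightLeaning (L₁ ++ interval a (b + c ∸ a))
  leaning′ = rightLeaning-++ x∈ (∈-resp-↭ (proj₁ split) y∈) λ z∈ z′∈ →
    <-≤-trans (L₁<a z∈) (proj₁ (∈-interval⁻ a (b + c ∸ a) z′∈))

data Placement (c : ℕ) : ℕ → ℕ → Set where
  same      : ∀ i → Placement c i i
  before    : ∀ i e → Placement c i (i + c + e)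
  after     : ∀ j e → Placement c (j + c + e) j
  overlapsʳ : ∀ i d → 0 < d → d < c → Placement c i (i + d)
  overlapsˡ : ∀ j d → 0 < d → d < c → Placement c (j + d) j

offset<length : ∀ {i j c} → i < j → ¬ (i + c ≤ j) → j ∸ i < c
offset<length {i} {c = c} i<j i+c≰j =
  subst (_ ∸ i <_) (m+n∸m≡n i c) (∸-monoˡ-< (≰⇒> i+c≰j) (<⇒≤ i<j))

placement : ∀ c i j → Placement c i j
placement c i j with <-cmp i j
... | tri≈ _ refl _ = same i
... | tri< i<j _ _ with i + c ≤? j
...   | yes i+c≤j = subst (Placement c i) (m+[n∸m]≡n i+c≤j) (before i (j ∸ (i + c)))
...   | no  i+c≰j = subst (Placement c i) (m+[n∸m]≡n (<⇒≤ i<j))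
                      (overlapsʳ i (j ∸ i) (m<n⇒0<n∸m i<j) (offset<length i<j i+c≰j))
placement c i j | tri> _ _ j<i with j + c ≤? i
...   | yes j+c≤i = subst (λ k → Placement c k j) (m+[n∸m]≡n j+c≤i) (after j (i ∸ (j + c)))
...   | no  j+c≰i = subst (λ k → Placement c k j) (m+[n∸m]≡n (<⇒≤ j<i))
                      (overlapsˡ j (i ∸ j) (m<n⇒0<n∸m j<i) (offset<length j<i j+c≰i))

interval-rightLeaning : ∀ a c → 1 < c → RightLeaning (interval a c)
interval-rightLeaning a (suc zero)    (s≤s ())
interval-rightLeaning a (suc (suc c)) _ = rightLeaning-++ {xs = a ∷ []} (here refl) (here refl)
  λ { (here refl) z∈ → proj₁ (∈-interval⁻ (suc a) (suc c) z∈) }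

formsR⇒1<c : ∀ {c X} → FormsR c X → 1 < c
formsR⇒1<c {c} ((b , X↭) , t , (t≥1 , _) , t<) =
  ≤-<-trans t≥1 (subst (_ <_) (trans (↭-length X↭) (length-interval b c)) t<)

formsR-splice-overlapʳ : ∀ {w a c i d} → Unique w → i + d + c ≤ length w → 0 < d → d < c
  → sub w i c ↭ interval a c → FormsR c (sub w (i + d) c)
  → FormsR c (sub (splice w i c (interval a c)) (i + d) c)
formsR-splice-overlapʳ {w} {a} {c} {i} {d} !w bound 0<d d<c h↭ h′ =
  subst (FormsR c) (sym new-window) (subst (λ n → FormsR c (drop n (interval a c) ++ L₃)) length-L₁
    (formsR-sort-overlapʳ L₁ L₂ L₃ (unique-blocks !w) (subst (_↭ _) first-window h↭)
      (subst (1 ≤_) (sym length-L₂) (m<n⇒0<n∸m d<c)) (subst (1 ≤_) (sym length-L₃) 0<d)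
      (subst (FormsR c) second-window h′)))
  where
  open Windows w i d c (<⇒≤ d<c) bound
  new-window = sub-splice-overlapʳ w (interval a c) i c d (length-interval a c)
                 (m+n≤o⇒m≤o i (m+n≤o⇒m≤o (i + d) bound)) (<⇒≤ d<c)

formsR-splice-overlapˡ : ∀ {w a c j d} → Unique w → j + d + c ≤ length w → 0 < d → d < c
  → sub w (j + d) c ↭ interval a c → FormsR c (sub w j c)
  → FormsR c (sub (splice w (j + d) c (interval a c)) j c)
formsR-splice-overlapˡ {w} {a} {c} {j} {d} !w bound 0<d d<c h↭ h′ =
  subst (FormsR c) (sym new-window) (subst (λ n → FormsR c (L₁ ++ take n (interval a c))) length-L₂
    (formsR-sort-overlapˡ L₁ L₂ L₃ (unique-blocks !w) (subst (_↭ _) second-window h↭)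
      (subst (1 ≤_) (sym length-L₁) 0<d) (subst (1 ≤_) (sym length-L₂) (m<n⇒0<n∸m d<c))
      (subst (FormsR c) first-window h′)))
  where
  open Windows w j d c (<⇒≤ d<c) bound
  new-window = sub-splice-overlapˡ w (interval a c) j c d (length-interval a c)
                 (m+n≤o⇒m≤o (j + d) bound) (<⇒≤ d<c)

formsR-splice : ∀ {w a c i j} → Unique w → i + c ≤ length w → j + c ≤ length w
  → sub w i c ↭ interval a c → FormsR c (sub w j c) → Placement c i j
  → FormsR c (sub (splice w i c (interval a c)) j c)
formsR-splice {w} {a} {c} _ i-bound _ _ h′ (same i) =
  subst (FormsR c) (sym (sub-splice-self w (interval a c) i c (length-interval a c) (m+n≤o⇒m≤o i i-bound)))
    ((a , ↭-refl) , interval-rightLeaning a c (formsR⇒1<c h′))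
formsR-splice {w} {a} {c} _ i-bound _ _ h′ (before i e) = subst (FormsR c)
  (sym (sub-splice-before w (interval a c) i c e (length-interval a c) (m+n≤o⇒m≤o i i-bound))) h′
formsR-splice {w} {a} {c} _ i-bound _ _ h′ (after j e) = subst (FormsR c)
  (sym (sub-splice-after w (interval a c) j c e (m+n≤o⇒m≤o (j + c + e) i-bound))) h′
formsR-splice !w _ j-bound h↭ h′ (overlapsʳ i d 0<d d<c) = formsR-splice-overlapʳ !w j-bound 0<d d<c h↭ h′
formsR-splice !w i-bound _ h↭ h′ (overlapsˡ j d 0<d d<c) = formsR-splice-overlapˡ !w i-bound 0<d d<c h↭ h′

straightening-sorts : ∀ {w w′ i c} → 1 ≤ c → Rearrangement w i c w′ → Straightened (range1 c) w′ i c
  → ∃ λ a → w′ ≡ splice w i c (interval a c) × sub w i c ↭ interval a c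
straightening-sorts {w} {i = i} {c} c≥1 ((bound , _) , v , v↭h , _ , refl) (_ , forms-α , _)
  with forms-range1⇒interval c≥1 (subst (λ X → Forms X (range1 c)) sub≡v forms-α)
  where
  sub≡v = sub-splice-self w v i c (trans (↭-length v↭h) (length-sub w i c bound)) (m+n≤o⇒m≤o i bound)
... | a , refl = a , refl , ↭-sym v↭h

unique-perm : ∀ {n w} → IsPerm n w → Unique w
unique-perm {n} w↭ = Unique-resp-↭ (↭⇒↭ₛ (↭-sym w↭)) (Unique.map⁺ suc-injective (Unique.upTo⁺ n))

lemma4p1 : (c n : ℕ) → 1 ≤ c → c ≤ n → (w : List ℕ) → IsPerm n w
    → (i j : ℕ) → SHit w i c → SHit w j c → RHit w j c
    → (w' : List ℕ) → Straightening (range1 c) w i c w'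
    → RHit w' j c
lemma4p1 c n c≥1 _ w w-perm i j hit-i _ rhit-j w′ (straighten , unchanged) with rhit? c≥1 hit-i
... | no ¬rhit-i = subst (λ u → RHit u j c) (sym (unchanged ¬rhit-i)) rhit-j
... | yes rhit-i with straighten rhit-i
... | rearranged , straightened with straightening-sorts c≥1 rearranged straightened
... | a , refl , h↭ = formsR⇒rhit j-bound′
  (formsR-splice (unique-perm w-perm) (proj₁ hit-i) (proj₁ rhit-j) h↭ (rhit⇒formsR c≥1 rhit-j) (placement c i j))
  where
  j-bound′ = subst (j + c ≤_) (sym (length-splice w (interval a c) i c (length-interval a c) (proj₁ hit-i)))
                   (proj₁ rhit-j)
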